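{- For any finite simple graph $G$, $\tau(G)=\nu'(G)$.
   Context: For $E_0\subseteq E(G)$, $V(E_0)$ is the set of endpoints of edges in $E_0$; $\tau(G)$ is the minimum of $|E_0|$ over all $E_0\subseteq E(G)$ such that $V(G)\setminus V(E_0)$ is an independent set of $G$. $\nu'(G)$ is the minimum size of a maximal matching of $G$. -}

module Defs where

open import Data.Nat using (ℕ; _≤_)
open import Data.Fin using (Fin) renaming (_<_ to _<ᶠ_)
open import Data.Bool using (Bool; true; false)
open import Data.List using (List; length)
open import Data.List.Membership.Propositional using (_∈_)
open import Data.List.Relation.Unary.All using (All)
open import Data.List.Relation.Unary.Unique.Propositional using (Unique)
open import Data.Product using (Σ; ∃; _×_; _,_)
open import Data.Sum using (_⊎_)
open import Relation.Binary.PropositionalEquality using (_≡_; _≢_)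
open import Relation.Nullary using (¬_)

record Graph (n : ℕ) : Set where
  field
    adj   : Fin n → Fin n → Bool
    sym   : ∀ u v → adj u v ≡ adj v u
    irrefl : ∀ u → adj u u ≡ false
open Graph public

-- An edge {u,v} of G, stored canonically as (u , v) with u < v.
IsEdge : ∀ {n} → Graph n → Fin n × Fin n → Set
IsEdge G (u , v) = (u <ᶠ v) × (adj G u v ≡ true)

-- A subset E₀ ⊆ E(G): a duplicate-free list of canonical edges; |E₀| = length.
record EdgeSet {n} (G : Graph n) : Set where
  constructor edgeSet
  field
    edges  : List (Fin n × Fin n)
    valid  : All (IsEdge G) edges
    unique : Unique edges
open EdgeSet public

_⊆ₑ_ : ∀ {n} {G : Graph n} → EdgeSet G → EdgeSet G → Set
A ⊆ₑ B = ∀ {e} → e ∈ edges A → e ∈ edges B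

size : ∀ {n} {G : Graph n} → EdgeSet G → ℕ
size E = length (edges E)

InV : ∀ {n} {G : Graph n} → EdgeSet G → Fin n → Set
InV E v = ∃ λ u → ((u , v) ∈ edges E) ⊎ ((v , u) ∈ edges E)

CoversToIndependent : ∀ {n} {G : Graph n} → EdgeSet G → Set
CoversToIndependent {G = G} E =
  ∀ u v → ¬ InV E u → ¬ InV E v → adj G u v ≡ false

EndpointOf : ∀ {n} → Fin n → Fin n × Fin n → Set
EndpointOf w (u , v) = (w ≡ u) ⊎ (w ≡ v)

IsMatching : ∀ {n} {G : Graph n} → EdgeSet G → Set
IsMatching M = ∀ {e f} → e ∈ edges M → f ∈ edges M → e ≢ f →
  ∀ w → EndpointOf w e → ¬ EndpointOf w f

IsMaximalMatching : ∀ {n} {G : Graph n} → EdgeSet G → Set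
IsMaximalMatching {G = G} M =
  IsMatching M × (∀ (M' : EdgeSet G) → IsMatching M' → M ⊆ₑ M' → M' ⊆ₑ M)

IsMinSize : ∀ {n} {G : Graph n} → (EdgeSet G → Set) → ℕ → Set
IsMinSize {G = G} P k =
  (Σ (EdgeSet G) λ E → P E × size E ≡ k) × (∀ (E : EdgeSet G) → P E → k ≤ size E)

IsTau : ∀ {n} → Graph n → ℕ → Set
IsTau G k = IsMinSize {G = G} CoversToIndependent k

IsNu' : ∀ {n} → Graph n → ℕ → Set
IsNu' G k = IsMinSize {G = G} IsMaximalMatching k

-- Every maximal matching M is an edge set whose unmatched vertices are independent, so τ ≤ ν'.
-- Conversely, let E be a minimum such edge set. Process the edges of E one by one, growing a
-- matching M: an edge with both endpoints unmatched is added to M, and an unmatched endpoint w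
-- of an edge is matched to an unmatched neighbour if it has one. Each edge of E adds at most
-- one edge to M, and afterwards every vertex of V(E) is matched or has only matched neighbours.
-- Since V(G) \ V(E) is independent, every edge of G then has a matched endpoint, i.e. M is a
-- maximal matching; hence ν' ≤ |M| ≤ |E| = τ.
module Submission where

open import Defs hiding (sym)
open import Data.Nat using (ℕ; suc; _≤_; _+_)
open import Data.Nat.Properties using (≤-refl; ≤-trans; ≤-antisym; m≤n+m; +-monoʳ-≤; +-assoc; +-comm; +-identityʳ)
open import Data.Fin using (Fin; zero; suc)
open import Data.Fin.Properties using (injective⇒≤; any?; all?; _<?_; <-cmp) renaming (_≟_ to _≟ᶠ_)
open import Data.Bool using (true; false)
open import Data.Bool.Properties using (¬-not) renaming (_≟_ to _≟ᵇ_)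
open import Data.List using (List; []; _∷_; [_]; _++_; map; filter; length; lookup; allFin; cartesianProduct)
open import Data.List.Membership.Propositional using (_∈_)
open import Data.List.Membership.Propositional.Properties
  using (∈-++⁺ˡ; ∈-++⁺ʳ; ∈-++⁻; ∈-map⁺; ∈-map⁻; ∈-filter⁺; ∈-filter⁻; ∈-lookup; ∈-allFin; ∈-cartesianProduct⁺)
import Data.List.Membership.Setoid.Properties as SetoidMembership
open import Data.List.Relation.Binary.Subset.Propositional using (_⊆_)
open import Data.List.Relation.Binary.Sublist.Propositional using ([]; _∷_; _∷ʳ_; ⊆-refl) renaming (_⊆_ to _⊑_)
open import Data.List.Relation.Binary.Sublist.Propositional.Properties using (All-resp-⊆; filter-⊆)
open import Data.List.Relation.Unary.Any using (here; there)
open import Data.List.Relation.Unary.All as All using (All; []; _∷_)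
open import Data.List.Relation.Unary.All.Properties using (all-filter)
open import Data.List.Relation.Unary.AllPairs using ([]; _∷_)
open import Data.List.Relation.Unary.Unique.Propositional using (Unique)
import Data.List.Relation.Unary.Unique.Propositional.Properties as Unique
open import Data.List.Extrema.Nat using (argmin; argmin-all; f[argmin]≤f[xs])
open import Data.Product using (∃; _×_; _,_; proj₁; proj₂)
open import Data.Product.Properties using (≡-dec)
open import Data.Sum as Sum using (_⊎_; inj₁; inj₂)
open import Data.Empty using (⊥; ⊥-elim)
open import Function using (_∘_; id; case_of_)
open import Function.Definitions using (Injective)
open import Relation.Binary.Definitions using (DecidableEquality; tri<; tri≈; tri>)
open import Relation.Binary.PropositionalEquality using (_≡_; _≢_; refl; sym; trans; cong; subst; setoid)
open import Relation.Nullary using (¬_; Dec; yes; no; contradiction)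
open import Relation.Nullary.Decidable using (_×-dec_; _⊎-dec_; _→-dec_; ¬?; decidable-stable)
open import Relation.Unary using (Pred; Decidable)

module _ {A : Set} where

  sublists : List A → List (List A)
  sublists []       = [ [] ]
  sublists (x ∷ xs) = sublists xs ++ map (x ∷_) (sublists xs)

  ∈-sublists⁺ : ∀ {xs ys : List A} → ys ⊑ xs → ys ∈ sublists xs
  ∈-sublists⁺ []                  = here refl
  ∈-sublists⁺ (_ ∷ʳ τ)            = ∈-++⁺ˡ (∈-sublists⁺ τ)
  ∈-sublists⁺ {x ∷ xs} (refl ∷ τ) = ∈-++⁺ʳ (sublists xs) (∈-map⁺ (x ∷_) (∈-sublists⁺ τ))

  ∈-sublists⁻ : ∀ {xs ys : List A} → ys ∈ sublists xs → ys ⊑ xs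
  ∈-sublists⁻ {[]} (here refl) = []
  ∈-sublists⁻ {x ∷ xs} p with ∈-++⁻ (sublists xs) p
  ... | inj₁ q = x ∷ʳ ∈-sublists⁻ q
  ... | inj₂ q with ∈-map⁻ (x ∷_) q
  ...   | _ , r , refl = refl ∷ ∈-sublists⁻ r

  minimalSublist : ∀ {p} {P : Pred (List A) p} → Decidable P → ∀ {xs : List A} → P xs →
                   ∃ λ ys → ys ⊑ xs × P ys × (∀ {zs} → zs ⊑ xs → P zs → length ys ≤ length zs)
  minimalSublist {P = P} P? {xs} pxs = ys , proj₁ admissible , proj₂ admissible , minimal
    where
      candidates : List (List A)
      candidates = filter P? (sublists xs)

      ys : List A
      ys = argmin length xs candidates

      admissible : ys ⊑ xs × P ys
      admissible = argmin-all length {P = λ ys → ys ⊑ xs × P ys} (⊆-refl , pxs)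
        (All.tabulate λ q → let r , pr = ∈-filter⁻ P? q in ∈-sublists⁻ r , pr)

      minimal : ∀ {zs} → zs ⊑ xs → P zs → length ys ≤ length zs
      minimal τ pzs = All.lookup (f[argmin]≤f[xs] xs candidates) (∈-filter⁺ P? (∈-sublists⁺ τ) pzs)

  Unique-resp-⊒ : ∀ {xs ys : List A} → ys ⊑ xs → Unique xs → Unique ys
  Unique-resp-⊒ []         []         = []
  Unique-resp-⊒ (_ ∷ʳ τ)   (_ ∷ u)    = Unique-resp-⊒ τ u
  Unique-resp-⊒ (refl ∷ τ) (x∉ ∷ u)   = All-resp-⊆ τ x∉ ∷ Unique-resp-⊒ τ u

  Unique⇒lookup-injective : ∀ {xs : List A} → Unique xs → Injective _≡_ _≡_ (lookup xs)
  Unique⇒lookup-injective (x∉ ∷ u) {zero}  {zero}  _  = refl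
  Unique⇒lookup-injective (x∉ ∷ u) {zero}  {suc j} eq = contradiction eq (All.lookup x∉ (∈-lookup j))
  Unique⇒lookup-injective (x∉ ∷ u) {suc i} {zero}  eq = contradiction (sym eq) (All.lookup x∉ (∈-lookup i))
  Unique⇒lookup-injective (x∉ ∷ u) {suc i} {suc j} eq = cong suc (Unique⇒lookup-injective u eq)

  Unique⇒length-mono-⊆ : ∀ {xs ys : List A} → Unique xs → xs ⊆ ys → length xs ≤ length ys
  Unique⇒length-mono-⊆ u xs⊆ys = injective⇒≤ λ {i} {j} eq →
    Unique⇒lookup-injective u
      (SetoidMembership.index-injective (setoid A) (xs⊆ys (∈-lookup i)) (xs⊆ys (∈-lookup j)) eq)

module _ {n : ℕ} (G : Graph n) where

  Edge : Set
  Edge = Fin n × Fin n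

  _≟ₑ_ : DecidableEquality Edge
  _≟ₑ_ = ≡-dec _≟ᶠ_ _≟ᶠ_

  open import Data.List.Membership.DecPropositional _≟ₑ_ using (_∈?_)

  Incident : List Edge → Fin n → Set
  Incident S v = ∃ λ u → ((u , v) ∈ S) ⊎ ((v , u) ∈ S)

  Covers : List Edge → Set
  Covers S = ∀ u v → ¬ Incident S u → ¬ Incident S v → adj G u v ≡ false

  Incident? : ∀ S v → Dec (Incident S v)
  Incident? S v = any? λ u → ((u , v) ∈? S) ⊎-dec ((v , u) ∈? S)

  Covers? : Decidable Covers
  Covers? S = all? λ u → all? λ v →
    ¬? (Incident? S u) →-dec (¬? (Incident? S v) →-dec (adj G u v ≟ᵇ false))

  covers-intro : ∀ {S} → (∀ {u v} → adj G u v ≡ true → ¬ Incident S u → ¬ Incident S v → ⊥) → Covers S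
  covers-intro h u v ¬u ¬v = ¬-not λ a → h a ¬u ¬v

  covers-elim : ∀ {S u v} → Covers S → adj G u v ≡ true → ¬ Incident S u → ¬ Incident S v → ⊥
  covers-elim c a ¬u ¬v with () ← trans (sym a) (c _ _ ¬u ¬v)

  Incident-mono : ∀ {S T} → S ⊆ T → ∀ {v} → Incident S v → Incident T v
  Incident-mono S⊆T (u , inj₁ p) = u , inj₁ (S⊆T p)
  Incident-mono S⊆T (u , inj₂ p) = u , inj₂ (S⊆T p)

  Covers-mono : ∀ {S T} → S ⊆ T → Covers S → Covers T
  Covers-mono S⊆T c u v ¬u ¬v = c u v (¬u ∘ Incident-mono S⊆T) (¬v ∘ Incident-mono S⊆T)

  endpoint⇒incident : ∀ {S e w} → e ∈ S → EndpointOf w e → Incident S w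
  endpoint⇒incident {e = u , v} e∈S (inj₁ refl) = v , inj₂ e∈S
  endpoint⇒incident {e = u , v} e∈S (inj₂ refl) = u , inj₁ e∈S

  adj⇒≢ : ∀ {u v} → adj G u v ≡ true → u ≢ v
  adj⇒≢ {u} a refl with () ← trans (sym a) (irrefl G u)

  orient : ∀ {u v} → adj G u v ≡ true → ∃ λ e → IsEdge G e × (e ≡ (u , v) ⊎ e ≡ (v , u))
  orient {u} {v} a with <-cmp u v
  ... | tri< u<v _ _ = (u , v) , (u<v , a) , inj₁ refl
  ... | tri≈ _ u≡v _ = contradiction u≡v (adj⇒≢ a)
  ... | tri> _ _ v<u = (v , u) , (v<u , trans (Graph.sym G v u) a) , inj₂ refl

  isEdge? : Decidable (IsEdge G)
  isEdge? (u , v) = (u <? v) ×-dec (adj G u v ≟ᵇ true)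

  allEdges : List Edge
  allEdges = filter isEdge? (cartesianProduct (allFin n) (allFin n))

  allEdges-valid : All (IsEdge G) allEdges
  allEdges-valid = all-filter isEdge? (cartesianProduct (allFin n) (allFin n))

  allEdges-unique : Unique allEdges
  allEdges-unique = Unique.filter⁺ isEdge? (Unique.cartesianProduct⁺ (Unique.allFin⁺ n) (Unique.allFin⁺ n))

  ∈-allEdges : ∀ {e} → IsEdge G e → e ∈ allEdges
  ∈-allEdges {u , v} = ∈-filter⁺ isEdge? (∈-cartesianProduct⁺ (∈-allFin u) (∈-allFin v))

  allEdges-covers : Covers allEdges
  allEdges-covers = covers-intro λ a ¬u _ → case orient a of λ where
    (_ , ie , inj₁ refl) → ¬u (endpoint⇒incident (∈-allEdges ie) (inj₁ refl))
    (_ , ie , inj₂ refl) → ¬u (endpoint⇒incident (∈-allEdges ie) (inj₂ refl))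

  restrict : EdgeSet G → List Edge
  restrict E = filter (_∈? edges E) allEdges

  edges⊆restrict : ∀ (E : EdgeSet G) → edges E ⊆ restrict E
  edges⊆restrict E e∈E = ∈-filter⁺ (_∈? edges E) (∈-allEdges (All.lookup (valid E) e∈E)) e∈E

  length-restrict≤size : ∀ (E : EdgeSet G) → length (restrict E) ≤ size E
  length-restrict≤size E = Unique⇒length-mono-⊆ (Unique.filter⁺ (_∈? edges E) allEdges-unique)
    (proj₂ ∘ ∈-filter⁻ (_∈? edges E) {xs = allEdges})

  minimumCover : ∃ λ (E : EdgeSet G) → CoversToIndependent E ×
                   ∀ (E' : EdgeSet G) → CoversToIndependent E' → size E ≤ size E'
  minimumCover with minimalSublist Covers? allEdges-covers
  ... | S , S⊑allEdges , S-covers , S-minimal =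
    edgeSet S (All-resp-⊆ S⊑allEdges allEdges-valid) (Unique-resp-⊒ S⊑allEdges allEdges-unique) ,
    S-covers ,
    λ E cover → ≤-trans (S-minimal (filter-⊆ _ allEdges) (Covers-mono (edges⊆restrict E) cover))
                        (length-restrict≤size E)

  record Extension (M : EdgeSet G) (k : ℕ) (P : EdgeSet G → Set) : Set where
    field
      M'       : EdgeSet G
      matching : IsMatching M'
      extends  : M ⊆ₑ M'
      bounded  : size M' ≤ k + size M
      property : P M'

  module _ {M : EdgeSet G} {P : EdgeSet G → Set} where

    stay : ∀ {k} → IsMatching M → P M → Extension M k P
    stay {k} mat pM = record { M' = M ; matching = mat ; extends = id ; bounded = m≤n+m _ k ; property = pM }

    Extension-map : ∀ {k Q} → (∀ {M'} → M ⊆ₑ M' → P M' → Q M') → Extension M k P → Extension M k Q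
    Extension-map f ext = record { Extension ext ; property = f extends property }
      where open Extension ext

    chain : ∀ {k l Q} → (∀ {M₁ M₂} → M₁ ⊆ₑ M₂ → P M₁ → P M₂) →
            Extension M k P → (∀ {M₁} → IsMatching M₁ → Extension M₁ l Q) →
            Extension M (k + l) (λ M₂ → P M₂ × Q M₂)
    chain {k} {l} {Q} P-mono ext₁ next = record
      { M'       = Extension.M' ext₂
      ; matching = Extension.matching ext₂
      ; extends  = Extension.extends ext₂ ∘ Extension.extends ext₁
      ; bounded  = ≤-trans (Extension.bounded ext₂) (reassociate (+-monoʳ-≤ l (Extension.bounded ext₁)))
      ; property = P-mono (Extension.extends ext₂) (Extension.property ext₁) , Extension.property ext₂
      }
      where
        ext₂ : Extension (Extension.M' ext₁) l Q
        ext₂ = next (Extension.matching ext₁)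
        reassociate : ∀ {m a} → a ≤ l + (k + m) → a ≤ k + l + m
        reassociate {m} {a} a≤ = subst (a ≤_) (trans (sym (+-assoc l k m)) (cong (_+ m) (+-comm l k))) a≤

  Free : EdgeSet G → Edge → Set
  Free M e = ∀ w → EndpointOf w e → ¬ InV M w

  free-pair : ∀ M {a b} → ¬ InV M a → ¬ InV M b → Free M (a , b)
  free-pair _ ¬a _ _ (inj₁ refl) = ¬a
  free-pair _ _ ¬b _ (inj₂ refl) = ¬b

  insert : (M : EdgeSet G) (e : Edge) → IsEdge G e → Free M e → EdgeSet G
  insert M e ie free = edgeSet (e ∷ edges M) (ie ∷ valid M)
    (All.tabulate (λ { f∈M refl → free _ (inj₁ refl) (endpoint⇒incident f∈M (inj₁ refl)) }) ∷ unique M)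

  insert-matching : ∀ {M e ie} → IsMatching M → (free : Free M e) → IsMatching (insert M e ie free)
  insert-matching mat free (here refl) (here refl) e≢e = contradiction refl e≢e
  insert-matching mat free (here refl) (there f∈M) _ w we wf = free w we (endpoint⇒incident f∈M wf)
  insert-matching mat free (there f∈M) (here refl) _ w wf we = free w we (endpoint⇒incident f∈M wf)
  insert-matching mat free (there p) (there q) e≢f = mat p q e≢f

  insertion : ∀ M {e} → IsMatching M → IsEdge G e → Free M e →
              Extension M 1 (λ M' → ∀ w → EndpointOf w e → InV M' w)
  insertion M {e} mat ie free = record
    { M' = insert M e ie free ; matching = insert-matching {M} {e} {ie} mat free ; extends = there
    ; bounded = ≤-refl ; property = λ _ → endpoint⇒incident (here refl) }

  augment : ∀ M {u v} → IsMatching M → adj G u v ≡ true → ¬ InV M u → ¬ InV M v →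
            Extension M 1 (λ M' → InV M' u)
  augment M mat a ¬u ¬v with orient a
  ... | _ , ie , inj₁ refl =
    Extension-map (λ _ inc → inc _ (inj₁ refl)) (insertion M mat ie (free-pair M ¬u ¬v))
  ... | _ , ie , inj₂ refl =
    Extension-map (λ _ inc → inc _ (inj₂ refl)) (insertion M mat ie (free-pair M ¬v ¬u))

  maximal⇒covers : ∀ {M : EdgeSet G} → IsMaximalMatching M → CoversToIndependent M
  maximal⇒covers {M} (mat , maximal) = covers-intro λ a ¬u ¬v →
    let open Extension (augment M mat a ¬u ¬v) in ¬u (Incident-mono (maximal M' matching extends) property)

  incident⇒endpoint : ∀ {S w} → Incident S w → ∃ λ e → e ∈ S × EndpointOf w e
  incident⇒endpoint (_ , inj₁ e∈S) = _ , e∈S , inj₂ refl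
  incident⇒endpoint (_ , inj₂ e∈S) = _ , e∈S , inj₁ refl

  covers⇒maximal : ∀ {M : EdgeSet G} → IsMatching M → CoversToIndependent M → IsMaximalMatching M
  covers⇒maximal {M} mat cover = mat , maximal
    where
      maximal : ∀ (M' : EdgeSet G) → IsMatching M' → M ⊆ₑ M' → M' ⊆ₑ M
      maximal M' mat' M⊆M' {e} e∈M' with e ∈? edges M
      ... | yes e∈M = e∈M
      ... | no e∉M = ⊥-elim (covers-elim cover (proj₂ (All.lookup (valid M') e∈M'))
                               (λ inc → clash inc (inj₁ refl)) (λ inc → clash inc (inj₂ refl)))
        where
          clash : ∀ {w} → InV M w → EndpointOf w e → ⊥
          clash inc we with f , f∈M , wf ← incident⇒endpoint inc =
            mat' (M⊆M' f∈M) e∈M' (λ { refl → e∉M f∈M }) _ wf we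

  -- z cannot be matched by extending M.
  Settled : EdgeSet G → Fin n → Set
  Settled M z = InV M z ⊎ (∀ y → adj G z y ≡ true → InV M y)

  SettledEdge : EdgeSet G → Edge → Set
  SettledEdge M (u , v) = Settled M u × Settled M v

  Settled-mono : ∀ {M M' : EdgeSet G} {z} → M ⊆ₑ M' → Settled M z → Settled M' z
  Settled-mono M⊆M' (inj₁ z∈) = inj₁ (Incident-mono M⊆M' z∈)
  Settled-mono M⊆M' (inj₂ nbrs) = inj₂ λ y a → Incident-mono M⊆M' (nbrs y a)

  SettledEdge-mono : ∀ {M M' : EdgeSet G} {e} → M ⊆ₑ M' → SettledEdge M e → SettledEdge M' e
  SettledEdge-mono {M} {M'} M⊆M' (su , sv) = Settled-mono {M} {M'} M⊆M' su , Settled-mono {M} {M'} M⊆M' sv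

  InV? : ∀ (M : EdgeSet G) v → Dec (InV M v)
  InV? M = Incident? (edges M)

  settle : ∀ M → IsMatching M → ∀ x → Extension M 1 (λ M' → Settled M' x)
  settle M mat x with InV? M x
  ... | yes x∈ = stay mat (inj₁ x∈)
  ... | no ¬x with any? (λ y → (adj G x y ≟ᵇ true) ×-dec ¬? (InV? M y))
  ...   | yes (y , a , ¬y) = Extension-map (λ _ → inj₁) (augment M mat a ¬x ¬y)
  ...   | no none = stay mat (inj₂ λ y a → decidable-stable (InV? M y) λ ¬y → none (y , a , ¬y))

  settleEdge : ∀ M {e} → IsMatching M → IsEdge G e → Extension M 1 (λ M' → SettledEdge M' e)
  settleEdge M {u , v} mat ie with InV? M u | InV? M v
  ... | yes u∈ | _ =
    Extension-map (λ {M'} M⊆M' sv → Settled-mono {M} {M'} M⊆M' (inj₁ u∈) , sv) (settle M mat v)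
  ... | no _ | yes v∈ =
    Extension-map (λ {M'} M⊆M' su → su , Settled-mono {M} {M'} M⊆M' (inj₁ v∈)) (settle M mat u)
  ... | no ¬u | no ¬v = Extension-map (λ _ inc → inj₁ (inc u (inj₁ refl)) , inj₁ (inc v (inj₂ refl)))
                                      (insertion M mat ie (free-pair M ¬u ¬v))

  settleAll : ∀ M {es} → IsMatching M → All (IsEdge G) es →
              Extension M (length es) (λ M' → All (SettledEdge M') es)
  settleAll M mat [] = stay mat []
  settleAll M {e ∷ es} mat (ie ∷ ies) = Extension-map (λ _ (s , ss) → s ∷ ss)
    (chain (λ {M₁} {M₂} → SettledEdge-mono {M₁} {M₂} {e}) (settleEdge M mat ie)
           (λ {M₁} mat₁ → settleAll M₁ mat₁ ies))

  settled⇒covers : ∀ {E M : EdgeSet G} → CoversToIndependent E → All (SettledEdge M) (edges E) →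
                   CoversToIndependent M
  settled⇒covers {E} {M} cover settled = covers-intro λ {u} {v} a ¬u ¬v →
    covers-elim cover a (unsettled ¬u λ nbrs → ¬v (nbrs v a))
                        (unsettled ¬v λ nbrs → ¬u (nbrs u (trans (Graph.sym G v u) a)))
    where
      settledOnV[E] : ∀ {w} → InV E w → Settled M w
      settledOnV[E] (_ , inj₁ e∈E) = proj₂ (All.lookup settled e∈E)
      settledOnV[E] (_ , inj₂ e∈E) = proj₁ (All.lookup settled e∈E)

      unsettled : ∀ {w} → ¬ InV M w → ¬ (∀ y → adj G w y ≡ true → InV M y) → ¬ InV E w
      unsettled ¬w ¬nbrs w∈ = Sum.[ ¬w , ¬nbrs ] (settledOnV[E] w∈)

  cover⇒maximalMatching : ∀ {E : EdgeSet G} → CoversToIndependent E →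
                          ∃ λ (M : EdgeSet G) → IsMaximalMatching M × size M ≤ size E
  cover⇒maximalMatching {E} cover =
    M' , covers⇒maximal {M'} matching (settled⇒covers {E} {M'} cover property) ,
    subst (size M' ≤_) (+-identityʳ (size E)) bounded
    where
      empty : EdgeSet G
      empty = edgeSet [] [] []

      open Extension (settleAll empty (λ ()) (valid E))

proposition2 : ∀ (n : ℕ) (G : Graph n) → ∃ λ (k : ℕ) → IsTau G k × IsNu' G k
proposition2 n G =
  let E , E-cover , E-minimum = minimumCover G
      M , M-maximal , M≤E = cover⇒maximalMatching G {E} E-cover
      E≤maximal : ∀ (M' : EdgeSet G) → IsMaximalMatching M' → size E ≤ size M'
      E≤maximal M' M'-maximal = E-minimum M' (maximal⇒covers G {M'} M'-maximal)
  in size E , ((E , E-cover , refl) , E-minimum)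
            , ((M , M-maximal , ≤-antisym M≤E (E≤maximal M M-maximal)) , E≤maximal)
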